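{- Let $\varphi=\vec{\mathbb{E}}\,\exists^T\pi_1\cdots\exists^T\pi_n\,\vec{\mathbb{Q}}\,\varphi_{qf}$ be a hypertrace formula in prenex normal form, where $\vec{\mathbb{E}}$ is any sequence of existential time quantifiers and existential unconstrained trace quantifiers, $\vec{\mathbb{Q}}$ is any sequence of time quantifiers and unconstrained trace quantifiers, and $\varphi_{qf}$ is quantifier-free. Then $\mathcal{L}(\varphi)\neq\emptyset$ iff $\mathcal{L}(\vec{\mathbb{E}}\,\exists\pi_1\cdots\exists\pi_n\,\vec{\mathbb{Q}}\,\varphi_{qf})\neq\emptyset$.
   Context: Fix a finite set $\mathcal{X}$ of propositional variables; a trace is an infinite sequence of subsets of $\mathcal{X}$, $(2^{\mathcal{X}})^\omega$ the set of all traces. Hypertrace formulas over trace variables and disjoint time variables: $\varphi ::= \exists\pi\,\varphi \mid \exists^{T}\pi\,\varphi \mid \exists i\,\varphi \mid \neg\varphi \mid \varphi\vee\varphi \mid i<j \mid i=j \mid x(\pi,i)$, $x\in\mathcal{X}$; $\exists\pi$ is an unconstrained trace quantifier, $\exists^T\pi$ a constrained trace quantifier, $\exists i$ a time quantifier; $\forall$ and $\forall^T$ are the dual abbreviations. Semantics over $T\subseteq(2^{\mathcal{X}})^\omega$ with a trace assignment and a time assignment: $\exists\pi$ ranges over all of $(2^{\mathcal{X}})^\omega$, $\exists^T\pi$ over $T$, $\exists i$ over $\mathbb{N}$; $<,=$ as in $\mathbb{N}$; $x(\pi,i)$ holds iff $x$ belongs to the valuation at position (value of $i$) of the trace assigned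 to $\pi$. $T\models\varphi$ iff some pair of assignments satisfies $\varphi$ over $T$; $\mathcal{L}(\varphi)=\{T\subseteq(2^{\mathcal{X}})^\omega\mid T\models\varphi\}$. -}

module Defs where

open import Data.Nat using (ℕ; _<_; _≟_)
open import Data.Fin using (Fin)
open import Data.Fin.Subset using (Subset; _∈_)
open import Data.List using (List; []; _∷_; map; foldr)
open import Data.Product using (Σ; _×_; _,_)
open import Data.Sum using (_⊎_)
open import Relation.Nullary using (¬_; yes; no)
open import Relation.Binary.PropositionalEquality using (_≡_)

-- Propositional variables: 𝒳 = Fin m (a finite set).
-- A valuation is a subset of 𝒳; a trace is an infinite sequence of valuations.
Trace : ℕ → Set
Trace m = ℕ → Subset m

TraceSet : ℕ → Set₁
TraceSet m = Trace m → Set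

TrVar : Set
TrVar = ℕ

TmVar : Set
TmVar = ℕ

data Formula (m : ℕ) : Set where
  ∃tr   : TrVar → Formula m → Formula m
  ∃trT  : TrVar → Formula m → Formula m
  ∃tm   : TmVar → Formula m → Formula m
  ¬'_   : Formula m → Formula m
  _∨'_  : Formula m → Formula m → Formula m
  _<'_  : TmVar → TmVar → Formula m
  _='_  : TmVar → TmVar → Formula m
  atom  : Fin m → TrVar → TmVar → Formula m

∀tr : ∀ {m} → TrVar → Formula m → Formula m
∀tr π φ = ¬' ∃tr π (¬' φ)

∀trT : ∀ {m} → TrVar → Formula m → Formula m
∀trT π φ = ¬' ∃trT π (¬' φ)

∀tm : ∀ {m} → TmVar → Formula m → Formula m
∀tm i φ = ¬' ∃tm i (¬' φ)

data QuantifierFree {m : ℕ} : Formula m → Set where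
  qf¬    : ∀ {φ} → QuantifierFree φ → QuantifierFree (¬' φ)
  qf∨    : ∀ {φ ψ} → QuantifierFree φ → QuantifierFree ψ → QuantifierFree (φ ∨' ψ)
  qf<    : ∀ i j → QuantifierFree (i <' j)
  qf=    : ∀ i j → QuantifierFree (i =' j)
  qfatom : ∀ x π i → QuantifierFree (atom x π i)

update : {A : Set} → (ℕ → A) → ℕ → A → ℕ → A
update f v a w with w ≟ v
... | yes _ = a
... | no _  = f w

Sat : ∀ {m} → TraceSet m → (TrVar → Trace m) → (TmVar → ℕ) → Formula m → Set
Sat T Π ι (∃tr π φ)   = Σ (Trace _) λ t → Sat T (update Π π t) ι φ
Sat T Π ι (∃trT π φ)  = Σ (Trace _) λ t → T t × Sat T (update Π π t) ι φ
Sat T Π ι (∃tm i φ)   = Σ ℕ λ n → Sat T Π (update ι i n) φ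
Sat T Π ι (¬' φ)      = ¬ Sat T Π ι φ
Sat T Π ι (φ ∨' ψ)    = Sat T Π ι φ ⊎ Sat T Π ι ψ
Sat T Π ι (i <' j)    = ι i < ι j
Sat T Π ι (i =' j)    = ι i ≡ ι j
Sat T Π ι (atom x π i) = x ∈ Π π (ι i)

_⊨_ : ∀ {m} → TraceSet m → Formula m → Set
T ⊨ φ = Σ (TrVar → Trace _) λ Π → Σ (TmVar → ℕ) λ ι → Sat T Π ι φ

LNonEmpty : ∀ {m} → Formula m → Set₁
LNonEmpty {m} φ = Σ (TraceSet m) λ T → T ⊨ φ

data EQuant : Set where
  eTm : TmVar → EQuant
  eTr : TrVar → EQuant

data QQuant : Set where
  qETm : TmVar → QQuant
  qATm : TmVar → QQuant
  qETr : TrVar → QQuant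
  qATr : TrVar → QQuant

applyE : ∀ {m} → EQuant → Formula m → Formula m
applyE (eTm i) φ = ∃tm i φ
applyE (eTr π) φ = ∃tr π φ

applyQ : ∀ {m} → QQuant → Formula m → Formula m
applyQ (qETm i) φ = ∃tm i φ
applyQ (qATm i) φ = ∀tm i φ
applyQ (qETr π) φ = ∃tr π φ
applyQ (qATr π) φ = ∀tr π φ

prefixE : ∀ {m} → List EQuant → Formula m → Formula m
prefixE qs φ = foldr applyE φ qs

prefixQ : ∀ {m} → List QQuant → Formula m → Formula m
prefixQ qs φ = foldr applyQ φ qs

prefixT : ∀ {m} → List TrVar → Formula m → Formula m
prefixT πs φ = foldr ∃trT φ πs

prefixU : ∀ {m} → List TrVar → Formula m → Formula m
prefixU πs φ = foldr ∃tr φ πs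

{-# OPTIONS --safe #-}
module Submission where

-- A formula without constrained quantifiers never consults T, so its truth
-- does not depend on the model.  Hence a model T of the unconstrained formula
-- can be replaced by the set of all traces, over which ∃^T and ∃ coincide.
-- Conversely ∃^T π implies ∃ π, and the existential prefix 𝔼⃗ preserves this
-- implication.

open import Defs
open import Data.Nat using (ℕ)
open import Data.List using (List; []; _∷_)
open import Data.Product using (_,_; map₂)
open import Data.Sum.Function.Propositional using (_⊎-⇔_)
open import Data.Unit using (⊤; tt)
open import Function.Bundles using (_⇔_; mk⇔; Equivalence)
open import Function.Related.TypeIsomorphisms using (¬-cong-⇔)

allTraces : ∀ {m} → TraceSet m
allTraces _ = ⊤

data Unconstrained {m : ℕ} : Formula m → Set where
  ∃tr   : ∀ {π φ} → Unconstrained φ → Unconstrained (∃tr π φ)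
  ∃tm   : ∀ {i φ} → Unconstrained φ → Unconstrained (∃tm i φ)
  ¬'_   : ∀ {φ} → Unconstrained φ → Unconstrained (¬' φ)
  _∨'_  : ∀ {φ ψ} → Unconstrained φ → Unconstrained ψ → Unconstrained (φ ∨' ψ)
  _<'_  : ∀ i j → Unconstrained (i <' j)
  _='_  : ∀ i j → Unconstrained (i =' j)
  atom  : ∀ x π i → Unconstrained (atom x π i)

quantifierFree⇒unconstrained : ∀ {m} {φ : Formula m} →
                               QuantifierFree φ → Unconstrained φ
quantifierFree⇒unconstrained (qf¬ q)        = ¬' quantifierFree⇒unconstrained q
quantifierFree⇒unconstrained (qf∨ p q)      =
  quantifierFree⇒unconstrained p ∨' quantifierFree⇒unconstrained q
quantifierFree⇒unconstrained (qf< i j)      = i <' j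
quantifierFree⇒unconstrained (qf= i j)      = i =' j
quantifierFree⇒unconstrained (qfatom x π i) = atom x π i

prefixQ-unconstrained : ∀ {m} (Q : List QQuant) {φ : Formula m} →
                        Unconstrained φ → Unconstrained (prefixQ Q φ)
prefixQ-unconstrained []            u = u
prefixQ-unconstrained (qETm i ∷ Q) u = ∃tm (prefixQ-unconstrained Q u)
prefixQ-unconstrained (qATm i ∷ Q) u = ¬' ∃tm (¬' prefixQ-unconstrained Q u)
prefixQ-unconstrained (qETr π ∷ Q) u = ∃tr (prefixQ-unconstrained Q u)
prefixQ-unconstrained (qATr π ∷ Q) u = ¬' ∃tr (¬' prefixQ-unconstrained Q u)

prefixU-unconstrained : ∀ {m} (πs : List TrVar) {φ : Formula m} →
                        Unconstrained φ → Unconstrained (prefixU πs φ)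
prefixU-unconstrained []       u = u
prefixU-unconstrained (π ∷ πs) u = ∃tr (prefixU-unconstrained πs u)

prefixE-unconstrained : ∀ {m} (E : List EQuant) {φ : Formula m} →
                        Unconstrained φ → Unconstrained (prefixE E φ)
prefixE-unconstrained []           u = u
prefixE-unconstrained (eTm i ∷ E) u = ∃tm (prefixE-unconstrained E u)
prefixE-unconstrained (eTr π ∷ E) u = ∃tr (prefixE-unconstrained E u)

module _ {m : ℕ} (T T′ : TraceSet m) where

  unconstrained⇒model-independent : {φ : Formula m} → Unconstrained φ →
                                    ∀ Π ι → Sat T Π ι φ ⇔ Sat T′ Π ι φ
  unconstrained⇒model-independent (∃tr u) Π ι =
    mk⇔ (map₂ (Equivalence.to   (unconstrained⇒model-independent u _ ι)))
        (map₂ (Equivalence.from (unconstrained⇒model-independent u _ ι)))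
  unconstrained⇒model-independent (∃tm u) Π ι =
    mk⇔ (map₂ (Equivalence.to   (unconstrained⇒model-independent u Π _)))
        (map₂ (Equivalence.from (unconstrained⇒model-independent u Π _)))
  unconstrained⇒model-independent (¬' u) Π ι =
    ¬-cong-⇔ (unconstrained⇒model-independent u Π ι)
  unconstrained⇒model-independent (u ∨' v) Π ι =
    unconstrained⇒model-independent u Π ι ⊎-⇔ unconstrained⇒model-independent v Π ι
  unconstrained⇒model-independent (i <' j)     Π ι = mk⇔ (λ s → s) (λ s → s)
  unconstrained⇒model-independent (i =' j)     Π ι = mk⇔ (λ s → s) (λ s → s)
  unconstrained⇒model-independent (atom x π i) Π ι = mk⇔ (λ s → s) (λ s → s)

prefixE-mono : ∀ {m} (T : TraceSet m) (E : List EQuant) {φ ψ : Formula m} →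
               (∀ Π ι → Sat T Π ι φ → Sat T Π ι ψ) →
               ∀ Π ι → Sat T Π ι (prefixE E φ) → Sat T Π ι (prefixE E ψ)
prefixE-mono T []           φ⇒ψ Π ι s       = φ⇒ψ Π ι s
prefixE-mono T (eTm i ∷ E) φ⇒ψ Π ι (n , s) = n , prefixE-mono T E φ⇒ψ Π _ s
prefixE-mono T (eTr π ∷ E) φ⇒ψ Π ι (t , s) = t , prefixE-mono T E φ⇒ψ _ ι s

prefixT⇒prefixU : ∀ {m} (T : TraceSet m) (πs : List TrVar) {φ : Formula m} →
                  ∀ Π ι → Sat T Π ι (prefixT πs φ) → Sat T Π ι (prefixU πs φ)
prefixT⇒prefixU T []       Π ι s           = s
prefixT⇒prefixU T (π ∷ πs) Π ι (t , _ , s) = t , prefixT⇒prefixU T πs _ ι s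

prefixU⇒prefixT-allTraces : ∀ {m} (πs : List TrVar) {φ : Formula m} →
  ∀ Π ι → Sat allTraces Π ι (prefixU πs φ) → Sat allTraces Π ι (prefixT πs φ)
prefixU⇒prefixT-allTraces []       Π ι s       = s
prefixU⇒prefixT-allTraces (π ∷ πs) Π ι (t , s) =
  t , tt , prefixU⇒prefixT-allTraces πs _ ι s

lemma3 : (m : ℕ) (E : List EQuant) (πs : List TrVar) (Q : List QQuant)
         (φqf : Formula m) → QuantifierFree φqf →
         LNonEmpty (prefixE E (prefixT πs (prefixQ Q φqf)))
           ⇔ LNonEmpty (prefixE E (prefixU πs (prefixQ Q φqf)))
lemma3 m E πs Q φqf qf = mk⇔ constrained⇒unconstrained unconstrained⇒constrained
  where
  constrained⇒unconstrained : LNonEmpty (prefixE E (prefixT πs (prefixQ Q φqf))) →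
                              LNonEmpty (prefixE E (prefixU πs (prefixQ Q φqf)))
  constrained⇒unconstrained (T , Π , ι , s) =
    T , Π , ι , prefixE-mono T E (prefixT⇒prefixU T πs) Π ι s

  unconstrained : Unconstrained (prefixE E (prefixU πs (prefixQ Q φqf)))
  unconstrained = prefixE-unconstrained E (prefixU-unconstrained πs
                    (prefixQ-unconstrained Q (quantifierFree⇒unconstrained qf)))

  unconstrained⇒constrained : LNonEmpty (prefixE E (prefixU πs (prefixQ Q φqf))) →
                              LNonEmpty (prefixE E (prefixT πs (prefixQ Q φqf)))
  unconstrained⇒constrained (T , Π , ι , s) =
    allTraces , Π , ι ,
    prefixE-mono allTraces E (prefixU⇒prefixT-allTraces πs) Π ι
      (Equivalence.to (unconstrained⇒model-independent T allTraces unconstrained Π ι) s)
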